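{- Let $(x,y,z,m,n)$ be a nontrivial solution in positive integers with $x>y$ of $\phi\left(z\frac{x^m-y^m}{x-y}\right)=z\frac{x^n-y^n}{x-y}$ such that $x\le 80$, $1\le z\le x-y$ and $\gcd(m,n)=1$. Let $d_1=\gcd(x,y)$, $x_1=x/d_1$, $y_1=y/d_1$. If $q$ is a prime factor of $m$, then $q\nmid x_1-y_1$.
   Context: $\phi$ is Euler's totient function. A solution $(x,y,z,m,n)$ of this equation in positive integers with $x>y$ is trivial if it equals $(a,b,1,1,1)$ for integers $a>b\ge1$; otherwise nontrivial. -}

module Defs where

open import Data.Nat using (ℕ; zero; suc; _+_; _*_; _∸_; _^_; _/_)
open import Data.Nat.GCD using (gcd)
open import Data.List using (List; length; filter; upTo; map)
open import Data.Nat using (_≟_)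

φ : ℕ → ℕ
φ n = length (filter (λ k → gcd k n ≟ 1) (map suc (upTo n)))

-- (x^k - y^k)/(x - y), natural-number truncated subtraction and floor division;
-- the divisor is nonzero whenever x > y (the only case used).
geomQ : ℕ → ℕ → ℕ → ℕ
geomQ x y k with x ∸ y
... | zero  = 0
... | suc d = (x ^ k ∸ y ^ k) / suc d

Trivial : ℕ → ℕ → ℕ → ℕ → ℕ → Set
Trivial x y z m n = (z ≡ 1) × (m ≡ 1) × (n ≡ 1)
  where open import Relation.Binary.PropositionalEquality using (_≡_)
        open import Data.Product using (_×_)

-- d₁ = gcd x y, x₁ = x / d₁, y₁ = y / d₁  (floor division; d₁ ≠ 0 whenever x > 0)
divBy : ℕ → ℕ → ℕ
divBy a zero    = 0
divBy a (suc d) = a / suc d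

x₁ : ℕ → ℕ → ℕ
x₁ x y = divBy x (gcd x y)

y₁ : ℕ → ℕ → ℕ
y₁ x y = divBy y (gcd x y)

-- Write x = d a and y = d b with a, b coprime, so that (x^k − y^k)/(x − y) = d^(k−1) g k
-- where g k = (a^k − b^k)/(a − b).  The equation reads φ(N) = W g n with N = z d^(m−1) g m
-- and W = z d^(n−1); as φ(N) ≤ N we get n ≤ m, so W ∣ z d^(m−1).
-- Suppose a prime q divides m and a − b.  Then a ≡ b (mod q) gives g k ≡ k a^(k−1) (mod q),
-- so q divides g m but not g n (q ∤ n as gcd(m,n) = 1, and q ∤ a as a, b are coprime).
-- Moreover g q ∣ g m and g q = q s with s > 1.  A prime p ∣ s is either q, or else a^q ≡ b^q
-- but a ≢ b (mod p), so a/b has order q modulo p and q ∣ p − 1.  Hence if q^e ∣ W, then N is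
-- divisible by q^e·q² or by q^e·q·p, in both cases q^(e+1) ∣ φ(N) = W g n, and so q^(e+1) ∣ W.
-- Every power of q then divides W ≥ 1, which is absurd.

module Submission where

open import Defs
open import Data.Nat
open import Data.Nat.Properties
open import Data.Nat.Divisibility
open import Data.Nat.DivMod
open import Data.Nat.GCD using (gcd; gcd-greatest; gcd[m,n]∣m; gcd[m,n]∣n; gcd[m,n]≢0; module Bézout)
open import Data.Nat.Coprimality as Coprimality using (Coprime; gcd≡1⇒coprime; coprime⇒gcd≡1; coprime-divisor)
open import Data.Nat.Primality
open import Data.Nat.Combinatorics using (_C_; nC1≡n; nCn≡1; k>n⇒nCk≡0; nCk+nC[k+1]≡[n+1]C[k+1])
open import Data.Nat.ListAction using (product)
open import Data.Nat.Primality.Factorisation using (factorise; PrimeFactorisation)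
open import Data.List using ([]; _∷_; length; filter; upTo; map; _++_; [_])
import Data.List.Properties as List
open import Data.List.Relation.Unary.All using (All; []; _∷_)
open import Data.Product using (∃-syntax; _×_; _,_)
open import Data.Sum using (_⊎_; inj₁; inj₂; [_,_]′)
open import Data.Empty using (⊥-elim)
open import Function.Base using (_∘_)
open import Function.Bundles using (_⇔_; mk⇔; Equivalence)
open import Relation.Nullary using (¬_; Dec; yes; no; contradiction)
open import Relation.Binary.PropositionalEquality hiding ([_])
open import Algebra.Properties.CommutativeSemigroup +-commutativeSemigroup using () renaming (interchange to +-interchange)
open import Algebra.Properties.CommutativeSemigroup *-commutativeSemigroup using (x∙yz≈y∙xz) renaming (interchange to *-interchange)
open import Data.Nat.Solver using (module +-*-Solver)
open +-*-Solver using (solve; _:=_; _:+_; _:*_; con)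

-- Sums over 1 … n

𝟙 : ∀ {P : Set} → Dec P → ℕ
𝟙 (yes _) = 1
𝟙 (no _)  = 0

𝟙≤1 : ∀ {P : Set} (P? : Dec P) → 𝟙 P? ≤ 1
𝟙≤1 (yes _) = ≤-refl
𝟙≤1 (no _)  = z≤n

𝟙-cong : ∀ {P Q : Set} → P ⇔ Q → (P? : Dec P) (Q? : Dec Q) → 𝟙 P? ≡ 𝟙 Q?
𝟙-cong P⇔Q (yes _) (yes _) = refl
𝟙-cong P⇔Q (no _)  (no _)  = refl
𝟙-cong P⇔Q (yes p) (no ¬q) = contradiction (Equivalence.to P⇔Q p) ¬q
𝟙-cong P⇔Q (no ¬p) (yes q) = contradiction (Equivalence.from P⇔Q q) ¬p

𝟙-no : ∀ {P : Set} → ¬ P → (P? : Dec P) → 𝟙 P? ≡ 0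
𝟙-no ¬p (yes p) = contradiction p ¬p
𝟙-no ¬p (no _)  = refl

sumTo : (ℕ → ℕ) → ℕ → ℕ
sumTo f zero    = 0
sumTo f (suc n) = sumTo f n + f (suc n)

sumTo-cong : ∀ f g n → (∀ k → 1 ≤ k → k ≤ n → f k ≡ g k) → sumTo f n ≡ sumTo g n
sumTo-cong f g zero    f≗g = refl
sumTo-cong f g (suc n) f≗g =
  cong₂ _+_ (sumTo-cong f g n (λ k 1≤k k≤n → f≗g k 1≤k (m≤n⇒m≤1+n k≤n))) (f≗g (suc n) (s≤s z≤n) ≤-refl)

sumTo-≤ : ∀ {f} n → (∀ k → f k ≤ 1) → sumTo f n ≤ n
sumTo-≤ zero    f≤1 = z≤n
sumTo-≤ (suc n) f≤1 = ≤-trans (+-mono-≤ (sumTo-≤ n f≤1) (f≤1 (suc n))) (≤-reflexive (+-comm n 1))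

sumTo-zero : ∀ f n → (∀ k → 1 ≤ k → k ≤ n → f k ≡ 0) → sumTo f n ≡ 0
sumTo-zero f zero    f≗0 = refl
sumTo-zero f (suc n) f≗0 =
  cong₂ _+_ (sumTo-zero f n (λ k 1≤k k≤n → f≗0 k 1≤k (m≤n⇒m≤1+n k≤n))) (f≗0 (suc n) (s≤s z≤n) ≤-refl)

sumTo-+ : ∀ f g n → sumTo (λ k → f k + g k) n ≡ sumTo f n + sumTo g n
sumTo-+ f g zero    = refl
sumTo-+ f g (suc n) = begin
  sumTo (λ k → f k + g k) n + (f (suc n) + g (suc n))  ≡⟨ cong (_+ (f (suc n) + g (suc n))) (sumTo-+ f g n) ⟩
  sumTo f n + sumTo g n + (f (suc n) + g (suc n))      ≡⟨ +-interchange (sumTo f n) _ _ _ ⟩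
  sumTo f (suc n) + sumTo g (suc n)                    ∎
  where open ≡-Reasoning

sumTo-++ : ∀ f m n → sumTo f (m + n) ≡ sumTo f m + sumTo (λ k → f (m + k)) n
sumTo-++ f m zero    = trans (cong (sumTo f) (+-identityʳ m)) (sym (+-identityʳ _))
sumTo-++ f m (suc n) = begin
  sumTo f (m + suc n)
    ≡⟨ cong (sumTo f) (+-suc m n) ⟩
  sumTo f (m + n) + f (suc (m + n))
    ≡⟨ cong₂ _+_ (sumTo-++ f m n) (cong f (sym (+-suc m n))) ⟩
  sumTo f m + sumTo (λ k → f (m + k)) n + f (m + suc n)
    ≡⟨ +-assoc (sumTo f m) _ _ ⟩
  sumTo f m + sumTo (λ k → f (m + k)) (suc n) ∎
  where open ≡-Reasoning

sumTo-periodic : ∀ f M → (∀ k → f (M + k) ≡ f k) → ∀ r → sumTo f (r * M) ≡ r * sumTo f M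
sumTo-periodic f M period zero    = refl
sumTo-periodic f M period (suc r) = begin
  sumTo f (M + r * M)
    ≡⟨ sumTo-++ f M (r * M) ⟩
  sumTo f M + sumTo (λ k → f (M + k)) (r * M)
    ≡⟨ cong (sumTo f M +_) (sumTo-cong (λ k → f (M + k)) f (r * M) (λ k _ _ → period k)) ⟩
  sumTo f M + sumTo f (r * M)
    ≡⟨ cong (sumTo f M +_) (sumTo-periodic f M period r) ⟩
  sumTo f M + r * sumTo f M ∎
  where open ≡-Reasoning

sumTo-multiples : ∀ p .{{_ : NonZero p}} (g : ℕ → ℕ) n →
  sumTo (λ k → 𝟙 (p ∣? k) * g k) (p * n) ≡ sumTo (λ i → g (p * i)) n
sumTo-multiples p g zero    = cong (sumTo (λ k → 𝟙 (p ∣? k) * g k)) (*-zeroʳ p)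
sumTo-multiples p@(suc p-1) g (suc n) = begin
  sumTo h (p * suc n)                                           ≡⟨ cong (sumTo h) p*[1+n] ⟩
  sumTo h (p * n + p)                                           ≡⟨ sumTo-++ h (p * n) p ⟩
  sumTo h (p * n) + (sumTo (λ k → h (p * n + k)) p-1 + h (p * n + p))
    ≡⟨ cong₂ _+_ (sumTo-multiples p g n) (cong₂ _+_ (sumTo-zero (λ k → h (p * n + k)) p-1 between) last) ⟩
  sumTo (λ i → g (p * i)) n + g (p * suc n)                     ∎
  where
  open ≡-Reasoning
  h : ℕ → ℕ
  h k = 𝟙 (p ∣? k) * g k
  p*[1+n] : p * suc n ≡ p * n + p
  p*[1+n] = trans (*-suc p n) (+-comm p (p * n))
  between : ∀ k → 1 ≤ k → k ≤ p-1 → h (p * n + k) ≡ 0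
  between k 1≤k k≤p-1 with p ∣? (p * n + k)
  ... | no _    = refl
  ... | yes p∣ = ⊥-elim (<⇒≱ (s≤s k≤p-1) (∣⇒≤ {{>-nonZero 1≤k}} (∣m+n∣m⇒∣n p∣ (m∣m*n n))))
  last : h (p * n + p) ≡ g (p * suc n)
  last with p ∣? (p * n + p)
  ... | yes _   = trans (+-identityʳ _) (cong g (sym p*[1+n]))
  ... | no p∤   = contradiction (∣m∣n⇒∣m+n (m∣m*n n) ∣-refl) p∤

length-filter-suc-upTo : ∀ {P : ℕ → Set} (P? : ∀ k → Dec (P k)) n →
  length (filter P? (map suc (upTo n))) ≡ sumTo (λ k → 𝟙 (P? k)) n
length-filter-suc-upTo P? zero    = refl
length-filter-suc-upTo P? (suc n) = begin
  length (filter P? (map suc (upTo (suc n))))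
    ≡⟨ cong (λ ks → length (filter P? (map suc ks))) (sym (List.upTo-∷ʳ n)) ⟩
  length (filter P? (map suc (upTo n ++ [ n ])))
    ≡⟨ cong (λ ks → length (filter P? ks)) (List.map-++ suc (upTo n) [ n ]) ⟩
  length (filter P? (map suc (upTo n) ++ [ suc n ]))
    ≡⟨ cong length (List.filter-++ P? (map suc (upTo n)) [ suc n ]) ⟩
  length (filter P? (map suc (upTo n)) ++ filter P? [ suc n ])
    ≡⟨ List.length-++ (filter P? (map suc (upTo n))) ⟩
  length (filter P? (map suc (upTo n))) + length (filter P? [ suc n ])
    ≡⟨ cong₂ _+_ (length-filter-suc-upTo P? n) length-filter-[x] ⟩
  sumTo (λ k → 𝟙 (P? k)) (suc n) ∎
  where
  open ≡-Reasoning
  length-filter-[x] : length (filter P? [ suc n ]) ≡ 𝟙 (P? (suc n))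
  length-filter-[x] with P? (suc n)
  ... | yes _ = refl
  ... | no _  = refl

prime>1 : ∀ {p} → Prime p → 1 < p
prime>1 {p} p-prime = nonTrivial⇒n>1 p {{prime⇒nonTrivial p-prime}}

prime∤1 : ∀ {p} → Prime p → ¬ p ∣ 1
prime∤1 p-prime p∣1 = <⇒≢ (prime>1 p-prime) (sym (∣1⇒≡1 p∣1))

prime∣^⇒∣ : ∀ {p m} n → Prime p → p ∣ m ^ n → p ∣ m
prime∣^⇒∣ zero    p-prime p∣1 = contradiction p∣1 (prime∤1 p-prime)
prime∣^⇒∣ {m = m} (suc n) p-prime p∣m^[1+n] with euclidsLemma m (m ^ n) p-prime p∣m^[1+n]
... | inj₁ p∣m   = p∣m
... | inj₂ p∣m^n = prime∣^⇒∣ n p-prime p∣m^n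

∃prime∣ : ∀ {n} → 1 < n → ∃[ p ] Prime p × p ∣ n
∃prime∣ {n} 1<n with factorise n {{>-nonZero (<-trans z<s 1<n)}}
... | record { factors = []     ; isFactorisation = n≡1 } = contradiction n≡1 (>⇒≢ 1<n)
... | record { factors = p ∷ ps ; isFactorisation = n≡p*ps ; factorsPrime = p-prime ∷ _ } =
  p , p-prime , subst (p ∣_) (sym n≡p*ps) (m∣m*n (product ps))

prime∣prime⇒≡ : ∀ {p q} → Prime p → Prime q → p ∣ q → p ≡ q
prime∣prime⇒≡ p-prime q-prime p∣q with prime⇒irreducible q-prime p∣q
... | inj₁ p≡1 = contradiction p≡1 (>⇒≢ (prime>1 p-prime))
... | inj₂ p≡q = p≡q

coprime-∣ʳ : ∀ {m n d} → d ∣ n → Coprime m n → Coprime m d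
coprime-∣ʳ d∣n m⊥n (i∣m , i∣d) = m⊥n (i∣m , ∣-trans i∣d d∣n)

coprime-∣ˡ : ∀ {m n d} → d ∣ m → Coprime m n → Coprime d n
coprime-∣ˡ d∣m m⊥n (i∣d , i∣n) = m⊥n (∣-trans i∣d d∣m , i∣n)

coprime-*ʳ : ∀ {k m n} → Coprime k m → Coprime k n → Coprime k (m * n)
coprime-*ʳ k⊥m k⊥n (i∣k , i∣mn) = k⊥n (i∣k , coprime-divisor (coprime-∣ˡ i∣k k⊥m) i∣mn)

coprime-^ʳ : ∀ {k m} e → Coprime k m → Coprime k (m ^ e)
coprime-^ʳ zero    k⊥m (_ , i∣1) = ∣1⇒≡1 i∣1
coprime-^ʳ (suc e) k⊥m = coprime-*ʳ k⊥m (coprime-^ʳ e k⊥m)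

coprime-+⁻ : ∀ {m n} → Coprime (n + m) n → Coprime m n
coprime-+⁻ n+m⊥n (i∣m , i∣n) = n+m⊥n (∣m∣n⇒∣m+n i∣n i∣m , i∣n)

prime∤⇒coprime : ∀ {p k} → Prime p → ¬ p ∣ k → Coprime k p
prime∤⇒coprime p-prime p∤k (i∣k , i∣p) with prime⇒irreducible p-prime i∣p
... | inj₁ i≡1 = i≡1
... | inj₂ refl = contradiction i∣k p∤k

-- Euler's totient

coprimeIndicator : ℕ → ℕ → ℕ
coprimeIndicator N k = 𝟙 (gcd k N ≟ 1)

coprimeIndicator-cong : ∀ {N N′} k k′ → Coprime k N ⇔ Coprime k′ N′ →
                        coprimeIndicator N k ≡ coprimeIndicator N′ k′
coprimeIndicator-cong {N} {N′} k k′ k⊥N⇔k′⊥N′ = 𝟙-cong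
  (mk⇔ (λ e → coprime⇒gcd≡1 (Equivalence.to k⊥N⇔k′⊥N′ (gcd≡1⇒coprime e)))
       (λ e → coprime⇒gcd≡1 (Equivalence.from k⊥N⇔k′⊥N′ (gcd≡1⇒coprime e))))
  (gcd k N ≟ 1) (gcd k′ N′ ≟ 1)

coprimeIndicator-¬ : ∀ {k N} → ¬ Coprime k N → coprimeIndicator N k ≡ 0
coprimeIndicator-¬ {k} {N} ¬k⊥N = 𝟙-no (λ e → ¬k⊥N (gcd≡1⇒coprime e)) (gcd k N ≟ 1)

coprimeIndicator-periodic : ∀ N k → coprimeIndicator N (N + k) ≡ coprimeIndicator N k
coprimeIndicator-periodic N k = coprimeIndicator-cong (N + k) k (mk⇔ coprime-+⁻ Coprimality.coprime-+)

φ≡sumTo : ∀ N → φ N ≡ sumTo (coprimeIndicator N) N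
φ≡sumTo N = length-filter-suc-upTo (λ k → gcd k N ≟ 1) N

φ≤ : ∀ N → φ N ≤ N
φ≤ N = subst (_≤ N) (sym (φ≡sumTo N)) (sumTo-≤ N (λ k → 𝟙≤1 (gcd k N ≟ 1)))

sumTo-coprimeIndicator : ∀ M r → sumTo (coprimeIndicator M) (r * M) ≡ r * φ M
sumTo-coprimeIndicator M r = begin
  sumTo (coprimeIndicator M) (r * M)
    ≡⟨ sumTo-periodic (coprimeIndicator M) M (coprimeIndicator-periodic M) r ⟩
  r * sumTo (coprimeIndicator M) M
    ≡⟨ cong (r *_) (φ≡sumTo M) ⟨
  r * φ M ∎
  where open ≡-Reasoning

φ[p*M]≡p*φ[M] : ∀ {p M} → Prime p → p ∣ M → φ (p * M) ≡ p * φ M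
φ[p*M]≡p*φ[M] {p} {M} p-prime p∣M = begin
  φ (p * M)
    ≡⟨ φ≡sumTo (p * M) ⟩
  sumTo (coprimeIndicator (p * M)) (p * M)
    ≡⟨ sumTo-cong _ _ (p * M) (λ k _ _ → coprimeIndicator-cong k k k⊥pM⇔k⊥M) ⟩
  sumTo (coprimeIndicator M) (p * M)
    ≡⟨ sumTo-coprimeIndicator M p ⟩
  p * φ M ∎
  where
  open ≡-Reasoning
  k⊥pM⇔k⊥M : ∀ {k} → Coprime k (p * M) ⇔ Coprime k M
  k⊥pM⇔k⊥M = mk⇔ (coprime-∣ʳ (n∣m*n p)) (λ k⊥M → coprime-*ʳ (coprime-∣ʳ p∣M k⊥M) k⊥M)

φ[p*M]+φ[M]≡p*φ[M] : ∀ {p M} → Prime p → ¬ p ∣ M → φ (p * M) + φ M ≡ p * φ M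
φ[p*M]+φ[M]≡p*φ[M] {p} {M} p-prime p∤M = begin
  φ (p * M) + φ M
    ≡⟨ cong₂ _+_ (φ≡sumTo (p * M)) (φ≡sumTo M) ⟩
  sumTo (coprimeIndicator (p * M)) (p * M) + sumTo (coprimeIndicator M) M
    ≡⟨ cong (sumTo (coprimeIndicator (p * M)) (p * M) +_) multiples ⟩
  sumTo (coprimeIndicator (p * M)) (p * M) + sumTo (λ k → 𝟙 (p ∣? k) * coprimeIndicator M k) (p * M)
    ≡⟨ sumTo-+ (coprimeIndicator (p * M)) _ (p * M) ⟨
  sumTo (λ k → coprimeIndicator (p * M) k + 𝟙 (p ∣? k) * coprimeIndicator M k) (p * M)
    ≡⟨ sumTo-cong _ _ (p * M) (λ k _ _ → split k) ⟩
  sumTo (coprimeIndicator M) (p * M)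
    ≡⟨ sumTo-coprimeIndicator M p ⟩
  p * φ M ∎
  where
  open ≡-Reasoning
  instance _ = prime⇒nonZero p-prime
  M⊥p : Coprime M p
  M⊥p = prime∤⇒coprime p-prime p∤M
  multiples : sumTo (coprimeIndicator M) M ≡ sumTo (λ k → 𝟙 (p ∣? k) * coprimeIndicator M k) (p * M)
  multiples = sym (trans (sumTo-multiples p (coprimeIndicator M) M)
    (sumTo-cong _ _ M (λ i _ _ → coprimeIndicator-cong (p * i) i
      (mk⇔ (coprime-∣ˡ (n∣m*n p)) (λ (i⊥M : Coprime i M) → Coprimality.sym (coprime-*ʳ M⊥p (Coprimality.sym i⊥M)))))))
  split : ∀ k → coprimeIndicator (p * M) k + 𝟙 (p ∣? k) * coprimeIndicator M k ≡ coprimeIndicator M k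
  split k with p ∣? k
  ... | yes p∣k = trans (cong (_+ _) (coprimeIndicator-¬ (λ k⊥pM → prime∤1 p-prime (subst (p ∣_) (k⊥pM (p∣k , m∣m*n M)) ∣-refl)))) (+-identityʳ _)
  ... | no p∤k  = trans (+-identityʳ _) (coprimeIndicator-cong k k (mk⇔ (coprime-∣ʳ (n∣m*n p)) (coprime-*ʳ (prime∤⇒coprime p-prime p∤k))))

φ[p*M]≡[p∸1]*φ[M] : ∀ {p M} → Prime p → ¬ p ∣ M → φ (p * M) ≡ (p ∸ 1) * φ M
φ[p*M]≡[p∸1]*φ[M] {p@(suc p-1)} {M} p-prime p∤M =
  +-cancelʳ-≡ (φ M) _ _ (trans (φ[p*M]+φ[M]≡p*φ[M] p-prime p∤M) (+-comm (φ M) (p-1 * φ M)))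

φ[M]∣φ[p*M] : ∀ {p} M → Prime p → φ M ∣ φ (p * M)
φ[M]∣φ[p*M] {p} M p-prime with p ∣? M
... | yes p∣M = subst (φ M ∣_) (sym (φ[p*M]≡p*φ[M] p-prime p∣M)) (n∣m*n p)
... | no p∤M  = subst (φ M ∣_) (sym (φ[p*M]≡[p∸1]*φ[M] p-prime p∤M)) (n∣m*n (p ∸ 1))

φ[M]∣φ[M*product] : ∀ M {ps} → All Prime ps → φ M ∣ φ (M * product ps)
φ[M]∣φ[M*product] M []                        = ∣-reflexive (cong φ (sym (*-identityʳ M)))
φ[M]∣φ[M*product] M {p ∷ ps} (p-prime ∷ ps-prime) =
  ∣-trans (φ[M]∣φ[M*product] M ps-prime)
          (subst (λ N → φ (M * product ps) ∣ φ N) (x∙yz≈y∙xz p M (product ps)) (φ[M]∣φ[p*M] (M * product ps) p-prime))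

φ-mono-∣ : ∀ {A N} → A ∣ N → φ A ∣ φ N
φ-mono-∣ {A} (divides zero    refl) = φ A ∣0
φ-mono-∣ {A} (divides r@(suc _) refl) =
  subst (λ N → φ A ∣ φ N) (trans (cong (A *_) (sym isFactorisation)) (*-comm A r)) (φ[M]∣φ[M*product] A factorsPrime)
  where open PrimeFactorisation (factorise r)

q^e∣φ[q^[1+e]] : ∀ {q} → Prime q → ∀ e → q ^ e ∣ φ (q ^ suc e)
q^e∣φ[q^[1+e]]         q-prime zero    = 1∣ _
q^e∣φ[q^[1+e]] {q} q-prime (suc e) =
  subst (q ^ suc e ∣_) (sym (φ[p*M]≡p*φ[M] q-prime (m∣m*n (q ^ e)))) (*-monoʳ-∣ q (q^e∣φ[q^[1+e]] q-prime e))

-- Congruences and geometric sums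

module _ (p : ℕ) .{{_ : NonZero p}} where

  +-cong-% : ∀ {a a′ b b′} → a % p ≡ a′ % p → b % p ≡ b′ % p → (a + b) % p ≡ (a′ + b′) % p
  +-cong-% {a} {a′} {b} {b′} a≡a′ b≡b′ =
    trans (%-distribˡ-+ a b p) (trans (cong₂ (λ u v → (u + v) % p) a≡a′ b≡b′) (sym (%-distribˡ-+ a′ b′ p)))

  *-cong-% : ∀ {a a′ b b′} → a % p ≡ a′ % p → b % p ≡ b′ % p → (a * b) % p ≡ (a′ * b′) % p
  *-cong-% {a} {a′} {b} {b′} a≡a′ b≡b′ =
    trans (%-distribˡ-* a b p) (trans (cong₂ (λ u v → (u * v) % p) a≡a′ b≡b′) (sym (%-distribˡ-* a′ b′ p)))

  ^-cong-% : ∀ {a b} k → a % p ≡ b % p → (a ^ k) % p ≡ (b ^ k) % p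
  ^-cong-% zero    a≡b = refl
  ^-cong-% (suc k) a≡b = *-cong-% a≡b (^-cong-% k a≡b)

^-distribʳ-* : ∀ m n k → (m * n) ^ k ≡ m ^ k * n ^ k
^-distribʳ-* m n zero    = refl
^-distribʳ-* m n (suc k) = begin
  m * n * (m * n) ^ k       ≡⟨ cong (m * n *_) (^-distribʳ-* m n k) ⟩
  m * n * (m ^ k * n ^ k)   ≡⟨ *-interchange m n (m ^ k) (n ^ k) ⟩
  m * m ^ k * (n * n ^ k)   ∎
  where open ≡-Reasoning

-- geom a b k = a^(k−1) + a^(k−2) b + … + b^(k−1) = (a^k − b^k)/(a − b)
geom : ℕ → ℕ → ℕ → ℕ
geom a b zero    = 0
geom a b (suc k) = a ^ k + b * geom a b k

geom-telescope : ∀ b t k → geom (b + t) b k * t + b ^ k ≡ (b + t) ^ k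
geom-telescope b t zero    = refl
geom-telescope b t (suc k) = begin
  ((b + t) ^ k + b * g) * t + b * b ^ k
    ≡⟨ solve 5 (λ A G T B P → (A :+ B :* G) :* T :+ B :* P := A :* T :+ B :* (G :* T :+ P)) refl ((b + t) ^ k) g t b (b ^ k) ⟩
  (b + t) ^ k * t + b * (g * t + b ^ k)
    ≡⟨ cong (λ u → (b + t) ^ k * t + b * u) (geom-telescope b t k) ⟩
  (b + t) ^ k * t + b * (b + t) ^ k
    ≡⟨ solve 3 (λ A T B → A :* T :+ B :* A := (B :+ T) :* A) refl ((b + t) ^ k) t b ⟩
  (b + t) * (b + t) ^ k ∎
  where
  open ≡-Reasoning
  g : ℕ
  g = geom (b + t) b k

geomQ≡geom : ∀ {x y} k → y < x → geomQ x y k ≡ geom x y k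
geomQ≡geom {x} {y} k y<x with x ∸ y in x∸y≡
... | zero  = contradiction x∸y≡ (>⇒≢ (m<n⇒0<n∸m y<x))
... | suc t-1 = begin
  (x ^ k ∸ y ^ k) / t                               ≡⟨ cong (λ u → (u ^ k ∸ y ^ k) / t) y+t≡x ⟨
  ((y + t) ^ k ∸ y ^ k) / t                         ≡⟨ cong (λ u → (u ∸ y ^ k) / t) (geom-telescope y t k) ⟨
  (geom (y + t) y k * t + y ^ k ∸ y ^ k) / t        ≡⟨ cong (_/ t) (m+n∸n≡m _ (y ^ k)) ⟩
  geom (y + t) y k * t / t                          ≡⟨ m*n/n≡m _ t ⟩
  geom (y + t) y k                                  ≡⟨ cong (λ u → geom u y k) y+t≡x ⟩
  geom x y k                                        ∎
  where
  open ≡-Reasoning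
  t : ℕ
  t = suc t-1
  y+t≡x : y + t ≡ x
  y+t≡x = trans (cong (y +_) (sym x∸y≡)) (m+[n∸m]≡n (<⇒≤ y<x))

geom-scale : ∀ d a b k → geom (d * a) (d * b) (suc k) ≡ d ^ k * geom a b (suc k)
geom-scale d a b zero    = trans (cong suc (*-zeroʳ (d * b))) (sym (trans (*-identityˡ _) (cong suc (*-zeroʳ b))))
geom-scale d a b (suc k) = begin
  (d * a) ^ suc k + d * b * geom (d * a) (d * b) (suc k)
    ≡⟨ cong₂ (λ u v → u + d * b * v) (^-distribʳ-* d a (suc k)) (geom-scale d a b k) ⟩
  d * d ^ k * a ^ suc k + d * b * (d ^ k * geom a b (suc k))
    ≡⟨ solve 5 (λ d D A b g → d :* D :* A :+ d :* b :* (D :* g) := d :* D :* (A :+ b :* g)) refl d (d ^ k) (a ^ suc k) b (geom a b (suc k)) ⟩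
  d * d ^ k * (a ^ suc k + b * geom a b (suc k)) ∎
  where open ≡-Reasoning

geom-+ : ∀ a b k l → geom a b (k + l) ≡ a ^ l * geom a b k + b ^ k * geom a b l
geom-+ a b zero    l = sym (trans (cong (_+ 1 * geom a b l) (*-zeroʳ (a ^ l))) (+-identityʳ _))
geom-+ a b (suc k) l = begin
  a ^ (k + l) + b * geom a b (k + l)
    ≡⟨ cong₂ (λ u v → u + b * v) (trans (^-distribˡ-+-* a k l) (*-comm (a ^ k) (a ^ l))) (geom-+ a b k l) ⟩
  a ^ l * a ^ k + b * (a ^ l * geom a b k + b ^ k * g)
    ≡⟨ solve 6 (λ L K b G B g → L :* K :+ b :* (L :* G :+ B :* g) := L :* (K :+ b :* G) :+ b :* B :* g) refl (a ^ l) (a ^ k) b (geom a b k) (b ^ k) g ⟩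
  a ^ l * geom a b (suc k) + b * b ^ k * g ∎
  where
  open ≡-Reasoning
  g : ℕ
  g = geom a b l

geom-∣ : ∀ a b {k m} → k ∣ m → geom a b k ∣ geom a b m
geom-∣ a b {k} (divides j refl) = subst (λ u → geom a b k ∣ geom a b u) (*-comm k j) (go j)
  where
  go : ∀ j → geom a b k ∣ geom a b (k * j)
  go zero    = subst (λ u → geom a b k ∣ geom a b u) (sym (*-zeroʳ k)) (_ ∣0)
  go (suc j) = subst (λ u → geom a b k ∣ geom a b u) (sym (*-suc k j))
    (subst (geom a b k ∣_) (sym (geom-+ a b k (k * j)))
      (∣m∣n⇒∣m+n (n∣m*n (a ^ (k * j))) (∣n⇒∣m*n (b ^ k) (go j))))

geom-diagonal : ∀ a k → geom a a (suc k) ≡ suc k * a ^ k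
geom-diagonal a zero    = trans (cong suc (*-zeroʳ a)) (sym (+-identityʳ 1))
geom-diagonal a (suc k) = begin
  a ^ suc k + a * geom a a (suc k)
    ≡⟨ cong (λ u → a ^ suc k + a * u) (geom-diagonal a k) ⟩
  a * a ^ k + a * (suc k * a ^ k)
    ≡⟨ solve 3 (λ a k A → a :* A :+ a :* ((con 1 :+ k) :* A) := (con 2 :+ k) :* (a :* A)) refl a k (a ^ k) ⟩
  suc (suc k) * a ^ suc k ∎
  where open ≡-Reasoning

module _ (p : ℕ) .{{_ : NonZero p}} {a b : ℕ} (a≡b : a % p ≡ b % p) where

  geom-cong-% : ∀ k → geom a b k % p ≡ geom a a k % p
  geom-cong-% zero    = refl
  geom-cong-% (suc k) = +-cong-% p {a ^ k} refl (*-cong-% p (sym a≡b) (geom-cong-% k))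

  geom≡[1+k]*a^k-mod : ∀ k → geom a b (suc k) % p ≡ (suc k * a ^ k) % p
  geom≡[1+k]*a^k-mod k = trans (geom-cong-% (suc k)) (cong (_% p) (geom-diagonal a k))

  ∣geom⇒∣[1+k]*a^k : ∀ k → p ∣ geom a b (suc k) → p ∣ suc k * a ^ k
  ∣geom⇒∣[1+k]*a^k k p∣g = m%n≡0⇒n∣m _ p (trans (sym (geom≡[1+k]*a^k-mod k)) (n∣m⇒m%n≡0 _ p p∣g))

  ∣[1+k]⇒∣geom : ∀ k → p ∣ suc k → p ∣ geom a b (suc k)
  ∣[1+k]⇒∣geom k p∣1+k = m%n≡0⇒n∣m _ p (trans (geom≡[1+k]*a^k-mod k) (n∣m⇒m%n≡0 _ p (∣m⇒∣m*n (a ^ k) p∣1+k)))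

prime∣geom⇒ : ∀ {p} .{{_ : NonZero p}} {a b} k → Prime p → a % p ≡ b % p →
              p ∣ geom a b (suc k) → p ∣ suc k ⊎ p ∣ a
prime∣geom⇒ {p} {a} k p-prime a≡b p∣g
  with euclidsLemma (suc k) (a ^ k) p-prime (∣geom⇒∣[1+k]*a^k p a≡b k p∣g)
... | inj₁ p∣1+k = inj₁ p∣1+k
... | inj₂ p∣a^k = inj₂ (prime∣^⇒∣ k p-prime p∣a^k)

module _ {a b : ℕ} (1≤a : 1 ≤ a) (1≤b : 1 ≤ b) where

  geom-<-suc : ∀ k → geom a b k < geom a b (suc k)
  geom-<-suc k = +-mono-≤ (m^n>0 a {{>-nonZero 1≤a}} k) (m≤n*m (geom a b k) b {{>-nonZero 1≤b}})

  geom-strictMono : ∀ {k l} → k < l → geom a b k < geom a b l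
  geom-strictMono {k} {suc l} k<1+l with m<1+n⇒m<n∨m≡n k<1+l
  ... | inj₁ k<l  = <-trans (geom-strictMono k<l) (geom-<-suc l)
  ... | inj₂ refl = geom-<-suc k

  geom-cancel-≤ : ∀ {k l} → geom a b k ≤ geom a b l → k ≤ l
  geom-cancel-≤ {k} {l} gk≤gl with k ≤? l
  ... | yes k≤l = k≤l
  ... | no k≰l  = contradiction gk≤gl (<⇒≱ (geom-strictMono (≰⇒> k≰l)))

  geom-≥ : ∀ k → k ≤ geom a b k
  geom-≥ zero    = z≤n
  geom-≥ (suc k) = ≤-trans (s≤s (geom-≥ k)) (geom-<-suc k)

geom-> : ∀ {a b} k → 2 ≤ a → 1 ≤ b → 1 ≤ k → suc k < geom a b (suc k)
geom-> {a} {b} k 2≤a 1≤b 1≤k = +-mono-≤ 2≤a^k (≤-trans (geom-≥ 1≤a 1≤b k) (m≤n*m (geom a b k) b {{>-nonZero 1≤b}}))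
  where
  1≤a : 1 ≤ a
  1≤a = ≤-trans (s≤s z≤n) 2≤a
  2≤a^k : 2 ≤ a ^ k
  2≤a^k = ≤-trans 2≤a (subst (_≤ a ^ k) (^-identityʳ a) (^-monoʳ-≤ a {{>-nonZero 1≤a}} 1≤k))

-- Fermat's little theorem and the order of a/b modulo p

C-absorption : ∀ n k → suc k * (suc n C suc k) ≡ suc n * (n C k)
C-absorption n       zero    = trans (*-identityˡ _) (trans (nC1≡n (suc n)) (sym (*-identityʳ (suc n))))
C-absorption zero    (suc k) = begin
  (2 + k) * (1 C (2 + k)) ≡⟨ cong ((2 + k) *_) (k>n⇒nCk≡0 (s≤s (s≤s (z≤n {k})))) ⟩
  (2 + k) * 0           ≡⟨ *-zeroʳ (2 + k) ⟩
  0                     ≡⟨ k>n⇒nCk≡0 (s≤s (z≤n {k})) ⟨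
  0 C suc k             ≡⟨ *-identityˡ _ ⟨
  1 * (0 C suc k)       ∎
  where open ≡-Reasoning
C-absorption (suc n) (suc k) = begin
  (2 + k) * ((2 + n) C (2 + k))
    ≡⟨ cong ((2 + k) *_) (nCk+nC[k+1]≡[n+1]C[k+1] (suc n) (suc k)) ⟨
  (2 + k) * (X + Y)
    ≡⟨ solve 3 (λ k X Y → (con 2 :+ k) :* (X :+ Y) := X :+ (con 1 :+ k) :* X :+ (con 2 :+ k) :* Y) refl k X Y ⟩
  X + (1 + k) * X + (2 + k) * Y
    ≡⟨ cong₂ (λ u v → X + u + v) (C-absorption n k) (C-absorption n (suc k)) ⟩
  X + (1 + n) * (n C k) + (1 + n) * (n C suc k)
    ≡⟨ solve 4 (λ X n c c′ → X :+ (con 1 :+ n) :* c :+ (con 1 :+ n) :* c′ := X :+ (con 1 :+ n) :* (c :+ c′)) refl X n (n C k) (n C suc k) ⟩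
  X + (1 + n) * (n C k + n C suc k)
    ≡⟨ cong (λ u → X + (1 + n) * u) (nCk+nC[k+1]≡[n+1]C[k+1] n k) ⟩
  (2 + n) * X ∎
  where
  open ≡-Reasoning
  X : ℕ
  X = suc n C suc k
  Y : ℕ
  Y = suc n C suc (suc k)

prime∣C : ∀ {p k} → Prime p → 0 < k → k < p → p ∣ p C k
prime∣C {suc n} {suc k} p-prime _ 1+k<p
  with euclidsLemma (suc k) (suc n C suc k) p-prime (subst (suc n ∣_) (sym (C-absorption n k)) (m∣m*n (n C k)))
... | inj₁ p∣1+k = contradiction (∣⇒≤ p∣1+k) (<⇒≱ 1+k<p)
... | inj₂ p∣C   = p∣C

binomialSum : ℕ → ℕ → ℕ → ℕ
binomialSum n a zero    = 0
binomialSum n a (suc j) = binomialSum n a j + (n C j) * a ^ j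

binomialSum-pascal : ∀ n a j → binomialSum (suc n) a (suc j) ≡ binomialSum n a (suc j) + a * binomialSum n a j
binomialSum-pascal n a zero    = cong suc (sym (*-zeroʳ a))
binomialSum-pascal n a (suc j) = begin
  binomialSum (suc n) a (suc j) + (suc n C suc j) * (a * a ^ j)
    ≡⟨ cong₂ (λ u v → u + v * (a * a ^ j)) (binomialSum-pascal n a j) (sym (nCk+nC[k+1]≡[n+1]C[k+1] n j)) ⟩
  binomialSum n a (suc j) + a * binomialSum n a j + (n C j + n C suc j) * (a * a ^ j)
    ≡⟨ solve 6 (λ S₁ a S₀ c c′ A → S₁ :+ a :* S₀ :+ (c :+ c′) :* (a :* A) := S₁ :+ c′ :* (a :* A) :+ a :* (S₀ :+ c :* A)) refl
         (binomialSum n a (suc j)) a (binomialSum n a j) (n C j) (n C suc j) (a ^ j) ⟩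
  binomialSum n a (suc (suc j)) + a * binomialSum n a (suc j) ∎
  where open ≡-Reasoning

binomial-theorem : ∀ n a → (1 + a) ^ n ≡ binomialSum n a (suc n)
binomial-theorem zero    a = refl
binomial-theorem (suc n) a = begin
  (1 + a) * (1 + a) ^ n
    ≡⟨ cong ((1 + a) *_) (binomial-theorem n a) ⟩
  (1 + a) * binomialSum n a (suc n)
    ≡⟨ solve 2 (λ a S → (con 1 :+ a) :* S := S :+ con 0 :+ a :* S) refl a (binomialSum n a (suc n)) ⟩
  binomialSum n a (suc n) + 0 + a * binomialSum n a (suc n)
    ≡⟨ cong (λ c → binomialSum n a (suc n) + c * a ^ suc n + a * binomialSum n a (suc n)) (k>n⇒nCk≡0 (n<1+n n)) ⟨
  binomialSum n a (suc (suc n)) + a * binomialSum n a (suc n)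
    ≡⟨ binomialSum-pascal n a (suc n) ⟨
  binomialSum (suc n) a (suc (suc n)) ∎
  where open ≡-Reasoning

binomialSum≡1-mod : ∀ {p} .{{_ : NonZero p}} → Prime p → ∀ a j → j < p → binomialSum p a (suc j) % p ≡ 1 % p
binomialSum≡1-mod         p-prime a zero    _     = refl
binomialSum≡1-mod {p} p-prime a (suc j) 1+j<p =
  trans (%-remove-+ʳ (binomialSum p a (suc j)) (∣m⇒∣m*n (a ^ suc j) (prime∣C p-prime (s≤s z≤n) 1+j<p)))
        (binomialSum≡1-mod p-prime a j (<-trans (n<1+n j) 1+j<p))

fermat : ∀ {p} .{{_ : NonZero p}} → Prime p → ∀ a → (a ^ p) % p ≡ a % p
fermat {p@(suc p-1)} p-prime zero    = refl
fermat {p@(suc p-1)} p-prime (suc a) = begin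
  ((1 + a) ^ p) % p
    ≡⟨ cong (_% p) (binomial-theorem p a) ⟩
  (binomialSum p a p + (p C p) * a ^ p) % p
    ≡⟨ +-cong-% p {binomialSum p a p} {1} {(p C p) * a ^ p} {a ^ p} lower-terms (cong (_% p) top-term) ⟩
  (1 + a ^ p) % p
    ≡⟨ +-cong-% p {1} {1} {a ^ p} {a} refl (fermat p-prime a) ⟩
  (1 + a) % p ∎
  where
  open ≡-Reasoning
  lower-terms : binomialSum p a p % p ≡ 1 % p
  lower-terms = binomialSum≡1-mod p-prime a p-1 ≤-refl
  top-term : (p C p) * a ^ p ≡ a ^ p
  top-term = trans (cong (_* a ^ p) (nCn≡1 p)) (*-identityˡ (a ^ p))

fermat-iterate : ∀ {p} .{{_ : NonZero p}} → Prime p → ∀ a v → (a ^ ((p ∸ 1) * v + 1)) % p ≡ a % p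
fermat-iterate {p@(suc p-1)} p-prime a zero    =
  trans (cong (λ e → (a ^ e) % p) (cong (_+ 1) (*-zeroʳ p-1))) (cong (_% p) (*-identityʳ a))
fermat-iterate {p@(suc p-1)} p-prime a (suc v) = begin
  (a ^ (p-1 * suc v + 1)) % p
    ≡⟨ cong (λ e → (a ^ e) % p) (solve 2 (λ P v → P :* (con 1 :+ v) :+ con 1 := P :* v :+ (con 1 :+ P)) refl p-1 v) ⟩
  (a ^ (p-1 * v + p)) % p
    ≡⟨ cong (_% p) (^-distribˡ-+-* a (p-1 * v) p) ⟩
  (a ^ (p-1 * v) * a ^ p) % p
    ≡⟨ *-cong-% p {a ^ (p-1 * v)} {a ^ (p-1 * v)} {a ^ p} {a} refl (fermat p-prime a) ⟩
  (a ^ (p-1 * v) * a) % p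
    ≡⟨ cong (_% p) (trans (^-distribˡ-+-* a (p-1 * v) 1) (cong (a ^ (p-1 * v) *_) (*-identityʳ a))) ⟨
  (a ^ (p-1 * v + 1)) % p
    ≡⟨ fermat-iterate p-prime a v ⟩
  a % p ∎
  where open ≡-Reasoning


∃inverse-mod : ∀ {q P} → Coprime q P → 1 ≤ q → 1 ≤ P → ∃[ u ] ∃[ v ] q * u ≡ P * v + 1
∃inverse-mod {q} {P} q⊥P 1≤q 1≤P with Coprimality.coprime-Bézout q⊥P
... | Bézout.+- x y 1+yP≡xq = x , y , trans (*-comm q x) (trans (sym 1+yP≡xq) (trans (+-comm 1 (y * P)) (cong (_+ 1) (*-comm y P))))
∃inverse-mod {q@(suc q-1)} {1} q⊥P 1≤q 1≤P | Bézout.-+ _ _ _ = 1 , q-1 , trans (*-identityʳ q) (trans (+-comm 1 q-1) (cong (_+ 1) (sym (+-identityʳ q-1))))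
∃inverse-mod {q} {P@(suc (suc s-1))} q⊥P 1≤q 1≤P | Bézout.-+ x zero    1+xq≡0 = contradiction 1+xq≡0 1+n≢0
-- From 1 + x q = y P: q · x(P − 1) = P (y(P − 1) − 1) + 1.
∃inverse-mod {q} {P@(suc (suc s-1))} q⊥P 1≤q 1≤P | Bézout.-+ x (suc y-1) 1+xq≡yP =
  x * s , w , +-cancelʳ-≡ s _ _ (begin
    q * (x * s) + s
      ≡⟨ solve 3 (λ q x s → q :* (x :* s) :+ s := (con 1 :+ x :* q) :* s) refl q x s ⟩
    (1 + x * q) * s
      ≡⟨ cong (_* s) 1+xq≡yP ⟩
    suc y-1 * P * s
      ≡⟨ solve 2 (λ y s → (con 1 :+ y) :* (con 2 :+ s) :* (con 1 :+ s) := (con 2 :+ s) :* (s :+ y :* (con 1 :+ s)) :+ con 1 :+ (con 1 :+ s)) refl y-1 s-1 ⟩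
    P * w + 1 + s ∎)
  where
  open ≡-Reasoning
  s : ℕ
  s = suc s-1
  w : ℕ
  w = s-1 + y-1 * s

^-cancelʳ-% : ∀ {p q a b} .{{_ : NonZero p}} → Prime p → Prime q → ¬ q ∣ p ∸ 1 →
              (a ^ q) % p ≡ (b ^ q) % p → a % p ≡ b % p
^-cancelʳ-% {p} {q} {a} {b} p-prime q-prime q∤p-1 a^q≡b^q
  with ∃inverse-mod (Coprimality.sym (prime∤⇒coprime q-prime q∤p-1))
                    (≤-trans (s≤s z≤n) (prime>1 q-prime)) (∸-monoˡ-≤ 1 (prime>1 p-prime))
... | u , v , qu≡[p-1]v+1 = begin
  a % p                           ≡⟨ fermat-iterate p-prime a v ⟨
  (a ^ ((p ∸ 1) * v + 1)) % p     ≡⟨ cong (λ e → (a ^ e) % p) qu≡[p-1]v+1 ⟨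
  (a ^ (q * u)) % p               ≡⟨ cong (_% p) (^-*-assoc a q u) ⟨
  ((a ^ q) ^ u) % p               ≡⟨ ^-cong-% p u a^q≡b^q ⟩
  ((b ^ q) ^ u) % p               ≡⟨ cong (_% p) (^-*-assoc b q u) ⟩
  (b ^ (q * u)) % p               ≡⟨ cong (λ e → (b ^ e) % p) qu≡[p-1]v+1 ⟩
  (b ^ ((p ∸ 1) * v + 1)) % p     ≡⟨ fermat-iterate p-prime b v ⟩
  b % p                           ∎
  where open ≡-Reasoning

prime∣geom⇒∣p∸1 : ∀ {b t p q} → Coprime (b + t) b → Prime p → Prime q → p ≢ q →
                  p ∣ geom (b + t) b q → q ∣ p ∸ 1
prime∣geom⇒∣p∸1 {b} {t} {p} {q@(suc q-1)} a⊥b p-prime q-prime p≢q p∣g with q ∣? p ∸ 1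
... | yes q∣p-1 = q∣p-1
... | no  q∤p-1 = ⊥-elim ([ p∤q , p∤a ]′ (prime∣geom⇒ q-1 p-prime a≡b p∣g))
  where
  instance _ = prime⇒nonZero p-prime
  a^q≡b^q : ((b + t) ^ q) % p ≡ (b ^ q) % p
  a^q≡b^q = trans (cong (_% p) (sym (geom-telescope b t q))) (%-remove-+ˡ (b ^ q) (∣m⇒∣m*n t p∣g))
  a≡b : (b + t) % p ≡ b % p
  a≡b = ^-cancelʳ-% p-prime q-prime q∤p-1 a^q≡b^q
  p∤q : ¬ p ∣ q
  p∤q p∣q = p≢q (prime∣prime⇒≡ p-prime q-prime p∣q)
  p∤a : ¬ p ∣ b + t
  p∤a p∣a = prime∤1 p-prime (subst (p ∣_) (a⊥b (p∣a , p∣b)) ∣-refl)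
    where
    p∣b : p ∣ b
    p∣b = m%n≡0⇒n∣m b p (trans (sym a≡b) (n∣m⇒m%n≡0 (b + t) p p∣a))

∃divisor-raising-φ : ∀ {b t q} → 1 ≤ b → 1 ≤ t → Coprime (b + t) b → Prime q → q ∣ t →
                     ∃[ B ] B ∣ geom (b + t) b q × (∀ e → q ^ suc e ∣ φ (q ^ e * B))
∃divisor-raising-φ {b} {t} {q@(suc q-1)} 1≤b 1≤t a⊥b q-prime q∣t = raise (∃prime∣ 1<s)
  where
  instance _ = prime⇒nonZero q-prime
  g : ℕ
  g = geom (b + t) b q
  q∣g : q ∣ g
  q∣g = ∣[1+k]⇒∣geom q {b + t} {b} (%-remove-+ʳ b q∣t) q-1 ∣-refl
  s : ℕ
  s = quotient q∣g
  q*s∣g : q * s ∣ g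
  q*s∣g = ∣-reflexive (sym (m∣n⇒n≡m*quotient q∣g))
  1<s : 1 < s
  1<s = quotient>1 q∣g (geom-> q-1 (+-mono-≤ 1≤b 1≤t) 1≤b (≤-pred (prime>1 q-prime)))
  raise : ∃[ p ] Prime p × p ∣ s → ∃[ B ] B ∣ g × (∀ e → q ^ suc e ∣ φ (q ^ e * B))
  raise (p , p-prime , p∣s) with p ≟ q
  ... | yes refl = q * q , ∣-trans (*-monoʳ-∣ q p∣s) q*s∣g , λ e →
    subst (λ N → q ^ suc e ∣ φ N) (solve 2 (λ q Q → q :* (q :* Q) := Q :* (q :* q)) refl q (q ^ e))
      (q^e∣φ[q^[1+e]] q-prime (suc e))
  ... | no  p≢q  = q * p , ∣-trans (*-monoʳ-∣ q p∣s) q*s∣g , λ e →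
    subst (λ N → q ^ suc e ∣ φ N) (solve 3 (λ q p Q → p :* (q :* Q) := Q :* (q :* p)) refl q p (q ^ e))
      (subst (q ^ suc e ∣_) (sym (φ[p*M]≡[p∸1]*φ[M] p-prime (p≢q ∘ prime∣prime⇒≡ p-prime q-prime ∘ prime∣^⇒∣ (suc e) p-prime)))
        (*-pres-∣ q∣p-1 (q^e∣φ[q^[1+e]] q-prime e)))
    where
    q∣p-1 : q ∣ p ∸ 1
    q∣p-1 = prime∣geom⇒∣p∸1 a⊥b p-prime q-prime p≢q (∣-trans p∣s (∣-trans (n∣m*n q) q*s∣g))

n<m^n : ∀ {m} → 1 < m → ∀ n → n < m ^ n
n<m^n 1<m zero    = s≤s z≤n
n<m^n {m} 1<m (suc n) =
  ≤-<-trans (n<m^n 1<m n) (subst (m ^ n <_) (*-comm (m ^ n) m) (m<m*n (m ^ n) m 1<m))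
  where instance _ = >-nonZero (≤-<-trans z≤n (n<m^n 1<m n))

^-step-∣⇒≡0 : ∀ {q W} → 1 < q → (∀ e → q ^ e ∣ W → q ^ suc e ∣ W) → W ≡ 0
^-step-∣⇒≡0 {q} {zero}  1<q step = refl
^-step-∣⇒≡0 {q} {suc w} 1<q step = contradiction (∣⇒≤ (all (suc w))) (<⇒≱ (n<m^n 1<q (suc w)))
  where
  all : ∀ e → q ^ e ∣ suc w
  all zero    = 1∣ suc w
  all (suc e) = step e (all e)

^-monoʳ-∣ : ∀ m {k l} → k ≤ l → m ^ k ∣ m ^ l
^-monoʳ-∣ m {k} {l} k≤l =
  subst (m ^ k ∣_) (trans (sym (^-distribˡ-+-* m k (l ∸ k))) (cong (m ^_) (m+[n∸m]≡n k≤l))) (m∣m*n (m ^ (l ∸ k)))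

prime∣exponent⇒∤difference :
  ∀ {d b t z m n q} → 1 ≤ d → 1 ≤ b → 1 ≤ t → Coprime (b + t) b → 1 ≤ z → 1 ≤ m → 1 ≤ n →
  φ (z * geom (d * (b + t)) (d * b) m) ≡ z * geom (d * (b + t)) (d * b) n →
  gcd m n ≡ 1 → Prime q → q ∣ m → ¬ q ∣ t
prime∣exponent⇒∤difference {d} {b} {t} {z} {m@(suc m-1)} {n@(suc n-1)} {q}
  1≤d 1≤b 1≤t a⊥b 1≤z _ _ φ[N]≡ m⊥n q-prime q∣m q∣t =
  <⇒≢ (*-mono-≤ 1≤z (m^n>0 d {{>-nonZero 1≤d}} n-1)) (sym (^-step-∣⇒≡0 (prime>1 q-prime) raise))
  where
  instance _ = prime⇒nonZero q-prime
  a : ℕ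
  a = b + t
  g : ℕ → ℕ
  g = geom a b
  N : ℕ
  N = z * geom (d * a) (d * b) m
  W : ℕ
  W = z * d ^ n-1
  C : ℕ
  C = z * d ^ m-1
  φ[N]≡g[n]*W : φ N ≡ g n * W
  φ[N]≡g[n]*W = trans φ[N]≡ (trans (cong (z *_) (geom-scale d a b n-1)) 
                  (solve 3 (λ z D G → z :* (D :* G) := G :* (z :* D)) refl z (d ^ n-1) (g n)))
  N≡C*g[m] : N ≡ C * g m
  N≡C*g[m] = trans (cong (z *_) (geom-scale d a b m-1)) (sym (*-assoc z (d ^ m-1) (g m)))
  n≤m : n ≤ m
  n≤m = geom-cancel-≤ (*-mono-≤ 1≤d (≤-trans 1≤b (m≤m+n b t))) (*-mono-≤ 1≤d 1≤b)
          (*-cancelˡ-≤ z {{>-nonZero 1≤z}} (subst (_≤ N) φ[N]≡ (φ≤ N)))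
  W∣C : W ∣ C
  W∣C = *-monoʳ-∣ z (^-monoʳ-∣ d (≤-pred n≤m))
  q∤g[n] : ¬ q ∣ g n
  q∤g[n] q∣g[n] with prime∣geom⇒ n-1 q-prime (%-remove-+ʳ b q∣t) q∣g[n]
  ... | inj₁ q∣n = prime∤1 q-prime (subst (q ∣_) m⊥n (gcd-greatest q∣m q∣n))
  ... | inj₂ q∣a = prime∤1 q-prime (subst (q ∣_) (a⊥b (q∣a , ∣m+n∣m⇒∣n (subst (q ∣_) (+-comm b t) q∣a) q∣t)) ∣-refl)
  raise : ∀ e → q ^ e ∣ W → q ^ suc e ∣ W
  raise e q^e∣W with ∃divisor-raising-φ 1≤b 1≤t a⊥b q-prime q∣t
  ... | B , B∣g[q] , q^[1+e]∣φ = coprime-divisor q^[1+e]⊥g[n] (subst (q ^ suc e ∣_) φ[N]≡g[n]*W q^[1+e]∣φ[N])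
    where
    q^e*B∣N : q ^ e * B ∣ N
    q^e*B∣N = subst (q ^ e * B ∣_) (sym N≡C*g[m]) (*-pres-∣ (∣-trans q^e∣W W∣C) (∣-trans B∣g[q] (geom-∣ a b q∣m)))
    q^[1+e]∣φ[N] : q ^ suc e ∣ φ N
    q^[1+e]∣φ[N] = ∣-trans (q^[1+e]∣φ e) (φ-mono-∣ q^e*B∣N)
    q^[1+e]⊥g[n] : Coprime (q ^ suc e) (g n)
    q^[1+e]⊥g[n] = Coprimality.sym (coprime-^ʳ (suc e) (prime∤⇒coprime q-prime q∤g[n]))

divBy≡/ : ∀ a d .{{_ : NonZero d}} → divBy a d ≡ a / d
divBy≡/ a (suc d) = refl

lemma8 : (x y z m n : ℕ) →
    1 ≤ y → y < x → 1 ≤ z → 1 ≤ m → 1 ≤ n →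
    φ (z * geomQ x y m) ≡ z * geomQ x y n →
    ¬ Trivial x y z m n →
    x ≤ 80 → z ≤ x ∸ y → gcd m n ≡ 1 →
    (q : ℕ) → Prime q → q ∣ m →
    ¬ (q ∣ (x₁ x y ∸ y₁ x y))
lemma8 x@(suc _) y z m n 1≤y y<x 1≤z 1≤m 1≤n φ-eq _ _ _ m⊥n q q-prime q∣m q∣x₁-y₁ =
  prime∣exponent⇒∤difference (>-nonZero⁻¹ d) 1≤b (m<n⇒0<n∸m b<a) a⊥b 1≤z 1≤m 1≤n
    (subst₂ (λ u v → φ (z * u) ≡ z * v) (geomQ≡ m) (geomQ≡ n) φ-eq) m⊥n q-prime q∣m
    (subst (q ∣_) (cong₂ _∸_ (divBy≡/ x d) (divBy≡/ y d)) q∣x₁-y₁)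
  where
  d : ℕ
  d = gcd x y
  instance _ = ≢-nonZero (gcd[m,n]≢0 x y (inj₁ λ ()))
  a : ℕ
  a = x / d
  b : ℕ
  b = y / d
  t : ℕ
  t = a ∸ b
  d*a≡x : d * a ≡ x
  d*a≡x = m*[n/m]≡n (gcd[m,n]∣m x y)
  d*b≡y : d * b ≡ y
  d*b≡y = m*[n/m]≡n (gcd[m,n]∣n x y)
  1≤b : 1 ≤ b
  1≤b = *-cancelˡ-< d 0 b (subst₂ _<_ (sym (*-zeroʳ d)) (sym d*b≡y) 1≤y)
  b<a : b < a
  b<a = *-cancelˡ-< d b a (subst₂ _<_ (sym d*b≡y) (sym d*a≡x) y<x)
  b+t≡a : b + t ≡ a
  b+t≡a = m+[n∸m]≡n (<⇒≤ b<a)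
  a⊥b : Coprime (b + t) b
  a⊥b = subst (λ u → Coprime u b) (sym b+t≡a) (Coprimality.coprime-/gcd x y)
  geomQ≡ : ∀ k → geomQ x y k ≡ geom (d * (b + t)) (d * b) k
  geomQ≡ k = trans (geomQ≡geom k y<x) (sym (cong₂ (λ u v → geom u v k) (trans (cong (d *_) b+t≡a) d*a≡x) d*b≡y))
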